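{- Let $n$ be divisible by $3$, $r=n/3$, and let $\vec v=\underbrace{1\ldots1}_{2r}\underbrace{0\ldots0}_{r}\in\{0,1\}^n$. The equitable partitions $(C,\overline C)$ of $Q_n$ with quotient matrix $\begin{pmatrix}0&3r\\ r&2r\end{pmatrix}$ such that $\vec v\in C^\perp$ are in one-to-one correspondence with the (ordered) equitable partitions of $Q_{2r}$ with quotient matrix $\begin{pmatrix}0&0&2r\\ 0&0&2r\\ r&r&0\end{pmatrix}$.
   Context: $Q_m$ is the graph on $\{0,1\}^m$ (viewed as $\mathbb F_2^m$) with two words adjacent iff they differ in exactly one position. A partition $(C_i)_{i\in I}$ of the vertices of a graph is equitable with quotient matrix $(S_{i,j})$ if every vertex of $C_i$ has exactly $S_{i,j}$ neighbours in $C_j$. $\overline C$ is the complement of $C$. For $C\subseteq\{0,1\}^n$, the (affine) dual $C^\perp$ is the set of all $\vec w\in\{0,1\}^n$ such that $\langle\vec c,\vec w\rangle=0$ for all $\vec c\in C$, or $\langle\vec c,\vec w\rangle=1$ for all $\vec c\in C$, where $\langle (c_1,\ldots,c_n),(w_1,\ldots,w_n)\rangle=c_1w_1+\cdots+c_nw_n \bmod 2$. -}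

module Defs where

open import Data.Bool using (Bool; true; false; _∧_; _xor_; if_then_else_)
open import Data.Nat using (ℕ; zero; suc; _+_; _*_; _<ᵇ_; _≡ᵇ_)
open import Data.Fin using (Fin; toℕ; _≟_)
open import Data.List using (List; []; _∷_; _++_; map)
open import Data.Vec using (Vec; []; _∷_; zipWith; foldr; tabulate; lookup)
open import Data.Product using (Σ; _×_; ∃)
open import Data.Sum using (_⊎_)
open import Relation.Nullary.Decidable using (⌊_⌋)
open import Relation.Binary.PropositionalEquality using (_≡_)

-- Words of length m : the vertex set {0,1}^m of Q_m (true = 1, false = 0).
Word : ℕ → Set
Word m = Vec Bool m

allWords : (m : ℕ) → List (Word m)
allWords zero = [] ∷ []
allWords (suc m) = map (true ∷_) (allWords m) ++ map (false ∷_) (allWords m)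

hamming : {m : ℕ} → Word m → Word m → ℕ
hamming x y = foldr (λ _ → ℕ) (λ b k → (if b then 1 else 0) + k) 0 (zipWith _xor_ x y)

adjQ : {m : ℕ} → Word m → Word m → Bool
adjQ x y = hamming x y ≡ᵇ 1

countB : {A : Set} → (A → Bool) → List A → ℕ
countB p [] = 0
countB p (a ∷ as) = (if p a then 1 else 0) + countB p as

nbrsIn : (m : ℕ) → (Word m → Bool) → Word m → ℕ
nbrsIn m D x = countB (λ y → adjQ x y ∧ D y) (allWords m)

-- An (ordered) partition of the vertices of Q_m into cells indexed by Fin k,
-- given by the cell-assignment map P, is equitable with quotient matrix S
-- if every vertex of cell i has exactly S i j neighbours in cell j.
IsEquitable : (m k : ℕ) → (Word m → Fin k) → (Fin k → Fin k → ℕ) → Set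
IsEquitable m k P S = (x : Word m) (j : Fin k) → nbrsIn m (λ y → ⌊ P y ≟ j ⌋) x ≡ S (P x) j

cellOf : {m : ℕ} → (Word m → Bool) → Word m → Fin 2
cellOf C x = if C x then Fin.zero else Fin.suc Fin.zero

S2 : ℕ → Fin 2 → Fin 2 → ℕ
S2 r Fin.zero Fin.zero = 0
S2 r Fin.zero (Fin.suc Fin.zero) = 3 * r
S2 r (Fin.suc Fin.zero) Fin.zero = r
S2 r (Fin.suc Fin.zero) (Fin.suc Fin.zero) = 2 * r

S3 : ℕ → Fin 3 → Fin 3 → ℕ
S3 r Fin.zero Fin.zero = 0
S3 r Fin.zero (Fin.suc Fin.zero) = 0
S3 r Fin.zero (Fin.suc (Fin.suc Fin.zero)) = 2 * r
S3 r (Fin.suc Fin.zero) Fin.zero = 0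
S3 r (Fin.suc Fin.zero) (Fin.suc Fin.zero) = 0
S3 r (Fin.suc Fin.zero) (Fin.suc (Fin.suc Fin.zero)) = 2 * r
S3 r (Fin.suc (Fin.suc Fin.zero)) Fin.zero = r
S3 r (Fin.suc (Fin.suc Fin.zero)) (Fin.suc Fin.zero) = r
S3 r (Fin.suc (Fin.suc Fin.zero)) (Fin.suc (Fin.suc Fin.zero)) = 0

inner : {m : ℕ} → Word m → Word m → Bool
inner c w = foldr (λ _ → Bool) _xor_ false (zipWith _∧_ c w)

-- w ∈ C^⊥ (affine dual).
InDual : {m : ℕ} → (Word m → Bool) → Word m → Set
InDual {m} C w = ((c : Word m) → C c ≡ true → inner c w ≡ false)
               ⊎ ((c : Word m) → C c ≡ true → inner c w ≡ true)

vWord : (n r : ℕ) → Word n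
vWord n r = tabulate (λ i → toℕ i <ᵇ 2 * r)

_≐_ : {A B : Set} → (A → B) → (A → B) → Set
f ≐ g = ∀ a → f a ≡ g a

-- Split a word of Q_{3r} as x ++ y with x ∈ Q_{2r} and y ∈ Q_r. An ordered partition (C₀, C₁, C₂) of Q_{2r}
-- lifts to C = {x ++ y : x ∈ C₀, y even} ∪ {x ++ y : x ∈ C₁, y odd}. A neighbour of x ++ y changes either x
-- or y, and changing y flips its parity; counting both kinds of neighbours turns the quotient matrix of
-- (C₀, C₁, C₂) into that of (C, C̄) and back. Since ⟨x ++ y, v⟩ is the parity of x, v ∈ C^⊥ says that the
-- x-parts of C all have one parity p; the quotient matrix makes C₂ and C₀ ∪ C₁ the two colour classes of
-- the bipartite graph Q_{2r}, which gives this forwards. Conversely, when v ∈ C^⊥ a word x of parity p has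
-- no neighbour x′ ++ y in C, so equitability forces y ↦ [x ++ y ∈ C] to flip along every edge of Q_r; it
-- is thus the even or the odd half of Q_r, and this decides whether x goes to C₀ or C₁.
module Submission where

open import Defs
open import Data.Bool using (Bool; true; false; not; _∧_; _xor_; if_then_else_)
open import Data.Bool.Properties
  using (∧-identityʳ; ∧-zeroʳ; not-distribˡ-xor; not-distribʳ-xor; xor-assoc; xor-comm; xor-identityʳ; xor-same; xor-inverseˡ)
open import Data.Nat using (ℕ; zero; suc; _+_; _*_; _≤_; z≤n; s≤s; _<ᵇ_; _≡ᵇ_)
open import Data.Nat.Properties using (suc-injective; m≤n⇒m≤1+n; 1+n≰n; +-comm; +-assoc; +-suc; +-identityʳ; +-cancelˡ-≡; +-cancelʳ-≡)
open import Data.Fin using (Fin; zero; suc; _≟_; toℕ)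
open import Data.List using (List; []; _∷_; _++_; map; length)
open import Data.List.Properties using (length-map)
open import Data.List.Relation.Unary.All as All using (All; []; _∷_)
open import Data.List.Relation.Unary.All.Properties using (map⁺; map⁻)
open import Data.Vec using ([]; _∷_; tabulate; replicate; take; drop; splitAt) renaming (_++_ to _⊕_)
open import Data.Vec.Properties using (take++drop≡id; ++-injective)
open import Data.Product using (Σ; _×_; _,_; proj₁; proj₂)
open import Data.Sum using (inj₁; inj₂)
open import Function using (_∘_)
open import Relation.Nullary using (contradiction)
open import Relation.Nullary.Decidable using (⌊_⌋)
open import Relation.Binary.PropositionalEquality using (_≡_; refl; sym; trans; cong; cong₂; subst)
open import Relation.Binary.PropositionalEquality.Properties using (module ≡-Reasoning)
open ≡-Reasoning

pattern c₀ = zero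
pattern c₁ = suc zero
pattern c₂ = suc (suc zero)

module _ {A : Set} where

  countB-++ : (p : A → Bool) (L M : List A) → countB p (L ++ M) ≡ countB p L + countB p M
  countB-++ p [] M = refl
  countB-++ p (a ∷ L) M = trans (cong (_ +_) (countB-++ p L M)) (sym (+-assoc (if p a then 1 else 0) _ _))

  countB-map : {B : Set} (p : B → Bool) (f : A → B) (L : List A) → countB p (map f L) ≡ countB (p ∘ f) L
  countB-map p f [] = refl
  countB-map p f (a ∷ L) = cong (_ +_) (countB-map p f L)

  countB-cong : {p q : A → Bool} {L : List A} → All (λ a → p a ≡ q a) L → countB p L ≡ countB q L
  countB-cong [] = refl
  countB-cong (e ∷ es) rewrite e = cong (_ +_) (countB-cong es)

  countB-All : {p : A → Bool} {b : Bool} {L : List A} →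
    All (λ a → p a ≡ b) L → countB p L ≡ (if b then length L else 0)
  countB-All {b = true} [] = refl
  countB-All {b = false} [] = refl
  countB-All {b = true} (e ∷ es) rewrite e = cong suc (countB-All es)
  countB-All {b = false} (e ∷ es) rewrite e = countB-All es

  countB-≤-length : (p : A → Bool) (L : List A) → countB p L ≤ length L
  countB-≤-length p [] = z≤n
  countB-≤-length p (a ∷ L) with p a
  ... | true  = s≤s (countB-≤-length p L)
  ... | false = m≤n⇒m≤1+n (countB-≤-length p L)

  countB⇒All : (p : A → Bool) (b : Bool) (L : List A) →
    countB p L ≡ (if b then length L else 0) → All (λ a → p a ≡ b) L
  countB⇒All p b [] _ = []
  countB⇒All p b (a ∷ L) h with p a in e | b
  ... | true  | true  = e ∷ countB⇒All p true L (suc-injective h)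
  ... | false | false = e ∷ countB⇒All p false L h
  ... | true  | false = contradiction h λ ()
  ... | false | true  = contradiction (subst (_≤ length L) h (countB-≤-length p L)) 1+n≰n

  countB+countB-not : (p : A → Bool) (L : List A) → countB p L + countB (not ∘ p) L ≡ length L
  countB+countB-not p [] = refl
  countB+countB-not p (a ∷ L) with p a
  ... | true  = cong suc (countB+countB-not p L)
  ... | false = trans (+-suc _ _) (cong suc (countB+countB-not p L))

  countB-cells₃ : (P : A → Fin 3) (L : List A) →
    countB (λ a → ⌊ P a ≟ c₀ ⌋) L + countB (λ a → ⌊ P a ≟ c₁ ⌋) L + countB (λ a → ⌊ P a ≟ c₂ ⌋) L ≡ length L
  countB-cells₃ P [] = refl
  countB-cells₃ P (a ∷ L) with P a
  ... | c₀ = cong suc (countB-cells₃ P L)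
  ... | c₁ = trans (cong (_+ count c₂) (+-suc (count c₀) (count c₁))) (cong suc (countB-cells₃ P L))
    where
    count : Fin 3 → ℕ
    count j = countB (λ a → ⌊ P a ≟ j ⌋) L
  ... | c₂ = trans (+-suc (count c₀ + count c₁) (count c₂)) (cong suc (countB-cells₃ P L))
    where
    count : Fin 3 → ℕ
    count j = countB (λ a → ⌊ P a ≟ j ⌋) L

neighbours : {m : ℕ} → Word m → List (Word m)
neighbours [] = []
neighbours (b ∷ x) = (not b ∷ x) ∷ map (b ∷_) (neighbours x)

length-neighbours : {m : ℕ} (x : Word m) → length (neighbours x) ≡ m
length-neighbours [] = refl
length-neighbours (b ∷ x) = cong suc (trans (length-map (b ∷_) (neighbours x)) (length-neighbours x))

countB-allWords-suc : (m : ℕ) (p : Word (suc m) → Bool) →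
  countB p (allWords (suc m)) ≡ countB (p ∘ (true ∷_)) (allWords m) + countB (p ∘ (false ∷_)) (allWords m)
countB-allWords-suc m p =
  trans (countB-++ p (map (true ∷_) (allWords m)) _) (cong₂ _+_ (countB-map p (true ∷_) (allWords m)) (countB-map p (false ∷_) (allWords m)))

countB-allWords-const : (m : ℕ) → countB (λ _ → false) (allWords m) ≡ 0
countB-allWords-const m = countB-All (All.universal (λ _ → refl) (allWords m))

countB-hamming≡0 : {m : ℕ} (x : Word m) (p : Word m → Bool) →
  countB (λ y → (hamming x y ≡ᵇ 0) ∧ p y) (allWords m) ≡ (if p x then 1 else 0)
countB-hamming≡0 [] p = +-identityʳ _
countB-hamming≡0 {suc m} (true ∷ x) p = begin
  countB (λ y → (hamming (true ∷ x) y ≡ᵇ 0) ∧ p y) (allWords (suc m))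
    ≡⟨ countB-allWords-suc m _ ⟩
  countB (λ y → (hamming x y ≡ᵇ 0) ∧ p (true ∷ y)) (allWords m) + countB (λ _ → false) (allWords m)
    ≡⟨ cong₂ _+_ (countB-hamming≡0 x (p ∘ (true ∷_))) (countB-allWords-const m) ⟩
  (if p (true ∷ x) then 1 else 0) + 0
    ≡⟨ +-identityʳ _ ⟩
  (if p (true ∷ x) then 1 else 0) ∎
countB-hamming≡0 {suc m} (false ∷ x) p = begin
  countB (λ y → (hamming (false ∷ x) y ≡ᵇ 0) ∧ p y) (allWords (suc m))
    ≡⟨ countB-allWords-suc m _ ⟩
  countB (λ _ → false) (allWords m) + countB (λ y → (hamming x y ≡ᵇ 0) ∧ p (false ∷ y)) (allWords m)
    ≡⟨ cong₂ _+_ (countB-allWords-const m) (countB-hamming≡0 x (p ∘ (false ∷_))) ⟩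
  (if p (false ∷ x) then 1 else 0) ∎

nbrsIn≡countB-neighbours : (m : ℕ) (D : Word m → Bool) (x : Word m) → nbrsIn m D x ≡ countB D (neighbours x)
nbrsIn≡countB-neighbours zero D [] = refl
nbrsIn≡countB-neighbours (suc m) D (true ∷ x) = begin
  nbrsIn (suc m) D (true ∷ x)
    ≡⟨ countB-allWords-suc m _ ⟩
  nbrsIn m (D ∘ (true ∷_)) x + countB (λ y → (hamming x y ≡ᵇ 0) ∧ D (false ∷ y)) (allWords m)
    ≡⟨ cong₂ _+_ (nbrsIn≡countB-neighbours m (D ∘ (true ∷_)) x) (countB-hamming≡0 x (D ∘ (false ∷_))) ⟩
  countB (D ∘ (true ∷_)) (neighbours x) + (if D (false ∷ x) then 1 else 0)
    ≡⟨ +-comm _ (if D (false ∷ x) then 1 else 0) ⟩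
  (if D (false ∷ x) then 1 else 0) + countB (D ∘ (true ∷_)) (neighbours x)
    ≡⟨ cong ((if D (false ∷ x) then 1 else 0) +_) (countB-map D (true ∷_) (neighbours x)) ⟨
  countB D (neighbours (true ∷ x)) ∎
nbrsIn≡countB-neighbours (suc m) D (false ∷ x) = begin
  nbrsIn (suc m) D (false ∷ x)
    ≡⟨ countB-allWords-suc m _ ⟩
  countB (λ y → (hamming x y ≡ᵇ 0) ∧ D (true ∷ y)) (allWords m) + nbrsIn m (D ∘ (false ∷_)) x
    ≡⟨ cong₂ _+_ (countB-hamming≡0 x (D ∘ (true ∷_))) (nbrsIn≡countB-neighbours m (D ∘ (false ∷_)) x) ⟩
  (if D (true ∷ x) then 1 else 0) + countB (D ∘ (false ∷_)) (neighbours x)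
    ≡⟨ cong ((if D (true ∷ x) then 1 else 0) +_) (countB-map D (false ∷_) (neighbours x)) ⟨
  countB D (neighbours (false ∷ x)) ∎

countB-neighbours-++ : {m k : ℕ} (D : Word (m + k) → Bool) (x : Word m) (y : Word k) →
  countB D (neighbours (x ⊕ y))
    ≡ countB (λ x′ → D (x′ ⊕ y)) (neighbours x) + countB (λ y′ → D (x ⊕ y′)) (neighbours y)
countB-neighbours-++ D [] y = refl
countB-neighbours-++ D (b ∷ x) y = begin
  bit + countB D (map (b ∷_) (neighbours (x ⊕ y)))
    ≡⟨ cong (bit +_) (countB-map D (b ∷_) (neighbours (x ⊕ y))) ⟩
  bit + countB (D ∘ (b ∷_)) (neighbours (x ⊕ y))
    ≡⟨ cong (bit +_) (countB-neighbours-++ (D ∘ (b ∷_)) x y) ⟩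
  bit + (countB (λ x′ → D (b ∷ x′ ⊕ y)) (neighbours x) + countB (λ y′ → D (b ∷ x ⊕ y′)) (neighbours y))
    ≡⟨ +-assoc bit _ _ ⟨
  bit + countB (λ x′ → D (b ∷ x′ ⊕ y)) (neighbours x) + countB (λ y′ → D (b ∷ x ⊕ y′)) (neighbours y)
    ≡⟨ cong (λ n → bit + n + countB (λ y′ → D (b ∷ x ⊕ y′)) (neighbours y)) (countB-map (λ x′ → D (x′ ⊕ y)) (b ∷_) (neighbours x)) ⟨
  countB (λ x′ → D (x′ ⊕ y)) (neighbours (b ∷ x)) + countB (λ y′ → D (b ∷ x ⊕ y′)) (neighbours y) ∎
  where
  bit : ℕ
  bit = if D (not b ∷ x ⊕ y) then 1 else 0

parity : {m : ℕ} → Word m → Bool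
parity [] = false
parity (b ∷ x) = b xor parity x

parity-replicate-false : (m : ℕ) → parity (replicate m false) ≡ false
parity-replicate-false zero = refl
parity-replicate-false (suc m) = parity-replicate-false m

parity-neighbours : {m : ℕ} (x : Word m) → All (λ z → parity z ≡ not (parity x)) (neighbours x)
parity-neighbours [] = []
parity-neighbours (b ∷ x) =
  sym (not-distribˡ-xor b (parity x)) ∷ map⁺ (All.map (λ e → trans (cong (b xor_) e) (sym (not-distribʳ-xor b (parity x)))) (parity-neighbours x))

flips⇒≡xor-parity : {m : ℕ} (f : Word m → Bool) →
  (∀ x → All (λ z → f z ≡ not (f x)) (neighbours x)) → ∀ x → f x ≡ f (replicate m false) xor parity x
flips⇒≡xor-parity {zero} f flips [] = sym (xor-identityʳ (f []))
flips⇒≡xor-parity {suc m} f flips (b ∷ x) = begin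
  f (b ∷ x)                                              ≡⟨ flips⇒≡xor-parity (f ∘ (b ∷_)) flipsᵇ x ⟩
  f (b ∷ replicate m false) xor parity x                 ≡⟨ cong (_xor parity x) (first-bit b) ⟩
  (f (replicate (suc m) false) xor b) xor parity x       ≡⟨ xor-assoc (f (replicate (suc m) false)) b (parity x) ⟩
  f (replicate (suc m) false) xor parity (b ∷ x)         ∎
  where
  flipsᵇ : ∀ x → All (λ z → f (b ∷ z) ≡ not (f (b ∷ x))) (neighbours x)
  flipsᵇ x with flips (b ∷ x)
  ... | _ ∷ rest = map⁻ rest
  first-bit : ∀ c → f (c ∷ replicate m false) ≡ f (replicate (suc m) false) xor c
  first-bit false = sym (xor-identityʳ _)
  first-bit true with flips (replicate (suc m) false)
  ... | flipped ∷ _ = trans flipped (sym (xor-comm (f (replicate (suc m) false)) true))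

inner-prefix : {m k : ℕ} (x : Word m) (y : Word k) → inner (x ⊕ y) (tabulate (λ i → toℕ i <ᵇ m)) ≡ parity x
inner-prefix [] y = inner-zeroʳ y (λ i → toℕ i <ᵇ 0) λ { zero → refl ; (suc i) → refl }
  where
  inner-zeroʳ : {k : ℕ} (y : Word k) (f : Fin k → Bool) → (∀ i → f i ≡ false) → inner y (tabulate f) ≡ false
  inner-zeroʳ [] f f≡false = refl
  inner-zeroʳ (c ∷ y) f f≡false =
    cong₂ _xor_ (trans (cong (c ∧_) (f≡false zero)) (∧-zeroʳ c)) (inner-zeroʳ y (f ∘ suc) (f≡false ∘ suc))
inner-prefix (b ∷ x) y = cong₂ _xor_ (∧-identityʳ b) (inner-prefix x y)

++-elim : (m : ℕ) {k : ℕ} (Q : Word (m + k) → Set) → (∀ x y → Q (x ⊕ y)) → ∀ w → Q w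
++-elim m Q h w with splitAt m w
... | x , y , refl = h x y

cellOf-≟-c₀ : {m : ℕ} (C : Word m → Bool) (x : Word m) → ⌊ cellOf C x ≟ c₀ ⌋ ≡ C x
cellOf-≟-c₀ C x with C x
... | true  = refl
... | false = refl

cellOf-≟-c₁ : {m : ℕ} (C : Word m → Bool) (x : Word m) → ⌊ cellOf C x ≟ c₁ ⌋ ≡ not (C x)
cellOf-≟-c₁ C x with C x
... | true  = refl
... | false = refl

module _ {m : ℕ} where

  equitable₂ : (C : Word m → Bool) (S : Fin 2 → Fin 2 → ℕ) → (∀ a → S a c₀ + S a c₁ ≡ m) →
    (∀ x → countB C (neighbours x) ≡ S (cellOf C x) c₀) → IsEquitable m 2 (cellOf C) S
  equitable₂ C S rows column₀ x c₀ = begin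
    nbrsIn m (λ z → ⌊ cellOf C z ≟ c₀ ⌋) x        ≡⟨ nbrsIn≡countB-neighbours m _ x ⟩
    countB (λ z → ⌊ cellOf C z ≟ c₀ ⌋) (neighbours x) ≡⟨ countB-cong (All.universal (cellOf-≟-c₀ C) (neighbours x)) ⟩
    countB C (neighbours x)                        ≡⟨ column₀ x ⟩
    S (cellOf C x) c₀                              ∎
  equitable₂ C S rows column₀ x c₁ = +-cancelˡ-≡ (S (cellOf C x) c₀) _ _ (begin
    S (cellOf C x) c₀ + nbrsIn m (λ z → ⌊ cellOf C z ≟ c₁ ⌋) x
      ≡⟨ cong₂ _+_ (sym (column₀ x)) (nbrsIn≡countB-neighbours m _ x) ⟩
    countB C (neighbours x) + countB (λ z → ⌊ cellOf C z ≟ c₁ ⌋) (neighbours x)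
      ≡⟨ cong (countB C (neighbours x) +_) (countB-cong (All.universal (cellOf-≟-c₁ C) (neighbours x))) ⟩
    countB C (neighbours x) + countB (not ∘ C) (neighbours x)
      ≡⟨ trans (countB+countB-not C (neighbours x)) (length-neighbours x) ⟩
    m
      ≡⟨ rows (cellOf C x) ⟨
    S (cellOf C x) c₀ + S (cellOf C x) c₁ ∎)

  equitable₂⇒countB : (C : Word m → Bool) (S : Fin 2 → Fin 2 → ℕ) → IsEquitable m 2 (cellOf C) S →
    ∀ x → countB C (neighbours x) ≡ S (cellOf C x) c₀
  equitable₂⇒countB C S E x = begin
    countB C (neighbours x)                            ≡⟨ countB-cong (All.universal (sym ∘ cellOf-≟-c₀ C) (neighbours x)) ⟩
    countB (λ z → ⌊ cellOf C z ≟ c₀ ⌋) (neighbours x) ≡⟨ nbrsIn≡countB-neighbours m _ x ⟨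
    nbrsIn m (λ z → ⌊ cellOf C z ≟ c₀ ⌋) x            ≡⟨ E x c₀ ⟩
    S (cellOf C x) c₀                                  ∎

  equitable₃ : (P : Word m → Fin 3) (S : Fin 3 → Fin 3 → ℕ) → (∀ a → S a c₀ + S a c₁ + S a c₂ ≡ m) →
    (∀ x → nbrsIn m (λ z → ⌊ P z ≟ c₀ ⌋) x ≡ S (P x) c₀) →
    (∀ x → nbrsIn m (λ z → ⌊ P z ≟ c₁ ⌋) x ≡ S (P x) c₁) → IsEquitable m 3 P S
  equitable₃ P S rows column₀ column₁ x c₀ = column₀ x
  equitable₃ P S rows column₀ column₁ x c₁ = column₁ x
  equitable₃ P S rows column₀ column₁ x c₂ = +-cancelˡ-≡ (S (P x) c₀ + S (P x) c₁) _ _ (begin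
    S (P x) c₀ + S (P x) c₁ + count c₂  ≡⟨ cong (λ n → n + count c₂) (cong₂ _+_ (column₀ x) (column₁ x)) ⟨
    count c₀ + count c₁ + count c₂      ≡⟨ cong₂ _+_ (cong₂ _+_ (count≡countB c₀) (count≡countB c₁)) (count≡countB c₂) ⟩
    countB (λ z → ⌊ P z ≟ c₀ ⌋) (neighbours x) + countB (λ z → ⌊ P z ≟ c₁ ⌋) (neighbours x)
      + countB (λ z → ⌊ P z ≟ c₂ ⌋) (neighbours x)
                                        ≡⟨ trans (countB-cells₃ P (neighbours x)) (length-neighbours x) ⟩
    m                                   ≡⟨ rows (P x) ⟨
    S (P x) c₀ + S (P x) c₁ + S (P x) c₂ ∎)
    where
    count : Fin 3 → ℕ
    count j = nbrsIn m (λ z → ⌊ P z ≟ j ⌋) x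
    count≡countB : ∀ j → count j ≡ countB (λ z → ⌊ P z ≟ j ⌋) (neighbours x)
    count≡countB j = nbrsIn≡countB-neighbours m _ x

  equitable-resp-≐ : {k : ℕ} {P Q : Word m → Fin k} {S : Fin k → Fin k → ℕ} →
    P ≐ Q → IsEquitable m k P S → IsEquitable m k Q S
  equitable-resp-≐ {P = P} {Q} {S} P≐Q E x j = begin
    nbrsIn m (λ y → ⌊ Q y ≟ j ⌋) x
      ≡⟨ countB-cong (All.universal (λ y → cong (λ a → adjQ x y ∧ ⌊ a ≟ j ⌋) (sym (P≐Q y))) (allWords m)) ⟩
    nbrsIn m (λ y → ⌊ P y ≟ j ⌋) x ≡⟨ E x j ⟩
    S (P x) j                       ≡⟨ cong (λ a → S a j) (P≐Q x) ⟩
    S (Q x) j                       ∎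

InDual⇒inner-constant : {m : ℕ} {C : Word m → Bool} {w : Word m} →
  InDual C w → Σ Bool λ k → ∀ c → C c ≡ true → inner c w ≡ k
InDual⇒inner-constant (inj₁ ⟨c,w⟩≡0) = false , ⟨c,w⟩≡0
InDual⇒inner-constant (inj₂ ⟨c,w⟩≡1) = true , ⟨c,w⟩≡1

inner-constant⇒InDual : {m : ℕ} {C : Word m → Bool} {w : Word m} (k : Bool) →
  (∀ c → C c ≡ true → inner c w ≡ k) → InDual C w
inner-constant⇒InDual false = inj₁
inner-constant⇒InDual true  = inj₂

xor≡false⇒≡ : ∀ a b → a xor b ≡ false → a ≡ b
xor≡false⇒≡ true  true  _ = refl
xor≡false⇒≡ false false _ = refl

fibre : Fin 3 → Bool → Bool
fibre c₀ b = not b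
fibre c₁ b = b
fibre c₂ b = false

parityCell : Bool → Fin 3
parityCell false = c₀
parityCell true  = c₁

fibre≡≟parityCell : ∀ a b → fibre a b ≡ ⌊ a ≟ parityCell b ⌋
fibre≡≟parityCell c₀ false = refl
fibre≡≟parityCell c₀ true  = refl
fibre≡≟parityCell c₁ false = refl
fibre≡≟parityCell c₁ true  = refl
fibre≡≟parityCell c₂ false = refl
fibre≡≟parityCell c₂ true  = refl

fibre⇒≢c₂ : ∀ a b → fibre a b ≡ true → ⌊ a ≟ c₂ ⌋ ≡ false
fibre⇒≢c₂ c₀ b _ = refl
fibre⇒≢c₂ c₁ b _ = refl
fibre⇒≢c₂ c₂ b ()

fibre-injective : ∀ a a′ → (∀ b → fibre a b ≡ fibre a′ b) → a ≡ a′
fibre-injective c₀ c₀ _ = refl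
fibre-injective c₁ c₁ _ = refl
fibre-injective c₂ c₂ _ = refl
fibre-injective c₀ c₁ same = contradiction (same false) λ ()
fibre-injective c₀ c₂ same = contradiction (same false) λ ()
fibre-injective c₁ c₀ same = contradiction (same false) λ ()
fibre-injective c₁ c₂ same = contradiction (same true) λ ()
fibre-injective c₂ c₀ same = contradiction (same false) λ ()
fibre-injective c₂ c₁ same = contradiction (same true) λ ()

fibre-of-bit : ∀ c b → fibre (if c then c₀ else c₁) b ≡ c xor b
fibre-of-bit true  b = refl
fibre-of-bit false b = refl

-- With a = P x and b = parity y, this counts the neighbours x ++ y′ of x ++ y (y′ adjacent to y in Q_k)
-- lying in lift P: all k of them have parity not b.
flipCount : ℕ → Fin 3 → Bool → ℕ
flipCount k a b = if fibre a (not b) then k else 0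

module _ {m k : ℕ} where

  lift : (Word m → Fin 3) → Word (m + k) → Bool
  lift P w = fibre (P (take m w)) (parity (drop m w))

  lift-++ : (P : Word m → Fin 3) (x : Word m) (y : Word k) → lift P (x ⊕ y) ≡ fibre (P x) (parity y)
  lift-++ P x y with ++-injective (take m (x ⊕ y)) x (take++drop≡id m (x ⊕ y))
  ... | take≡x , drop≡y = cong₂ (λ x′ y′ → fibre (P x′) (parity y′)) take≡x drop≡y

  lift-cong : (P Q : Word m → Fin 3) → P ≐ Q → lift P ≐ lift Q
  lift-cong P Q P≐Q w = cong (λ a → fibre a (parity (drop m w))) (P≐Q (take m w))

  countB-lift-neighbours : (P : Word m → Fin 3) (x : Word m) (y : Word k) →
    countB (lift P) (neighbours (x ⊕ y))
      ≡ nbrsIn m (λ z → ⌊ P z ≟ parityCell (parity y) ⌋) x + flipCount k (P x) (parity y)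
  countB-lift-neighbours P x y = begin
    countB (lift P) (neighbours (x ⊕ y))
      ≡⟨ countB-neighbours-++ (lift P) x y ⟩
    countB (λ x′ → lift P (x′ ⊕ y)) (neighbours x) + countB (λ y′ → lift P (x ⊕ y′)) (neighbours y)
      ≡⟨ cong₂ _+_ (countB-cong (All.universal along-x (neighbours x))) (countB-All along-y) ⟩
    countB (λ z → ⌊ P z ≟ parityCell (parity y) ⌋) (neighbours x) + (if flipped then length (neighbours y) else 0)
      ≡⟨ cong₂ _+_ (sym (nbrsIn≡countB-neighbours m _ x)) (cong (λ n → if flipped then n else 0) (length-neighbours y)) ⟩
    nbrsIn m (λ z → ⌊ P z ≟ parityCell (parity y) ⌋) x + flipCount k (P x) (parity y) ∎
    where
    flipped : Bool
    flipped = fibre (P x) (not (parity y))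
    along-x : ∀ x′ → lift P (x′ ⊕ y) ≡ ⌊ P x′ ≟ parityCell (parity y) ⌋
    along-x x′ = trans (lift-++ P x′ y) (fibre≡≟parityCell (P x′) (parity y))
    along-y : All (λ y′ → lift P (x ⊕ y′) ≡ flipped) (neighbours y)
    along-y = All.map (λ {y′} e → trans (lift-++ P x y′) (cong (fibre (P x)) e)) (parity-neighbours y)

module _ {r : ℕ} where

  S2-rows : ∀ a → S2 r a c₀ + S2 r a c₁ ≡ 2 * r + r
  S2-rows c₀ = +-comm r (2 * r)
  S2-rows c₁ = +-comm r (2 * r)

  S3-rows : ∀ a → S3 r a c₀ + S3 r a c₁ + S3 r a c₂ ≡ 2 * r
  S3-rows c₀ = refl
  S3-rows c₁ = refl
  S3-rows c₂ = +-assoc r r 0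

  S3-column₂ : ∀ a → S3 r a c₂ ≡ (if not ⌊ a ≟ c₂ ⌋ then 2 * r else 0)
  S3-column₂ c₀ = refl
  S3-column₂ c₁ = refl
  S3-column₂ c₂ = refl

  S2-from-S3 : ∀ a b → S3 r a (parityCell b) + flipCount r a b ≡ S2 r (if fibre a b then c₀ else c₁) c₀
  S2-from-S3 c₀ false = refl
  S2-from-S3 c₀ true  = refl
  S2-from-S3 c₁ false = refl
  S2-from-S3 c₁ true  = refl
  S2-from-S3 c₂ false = +-identityʳ r
  S2-from-S3 c₂ true  = +-identityʳ r

  S2-cellOf-lift : (P : Word (2 * r) → Fin 3) (x : Word (2 * r)) (y : Word r) →
    S2 r (cellOf (lift P) (x ⊕ y)) c₀
      ≡ S3 r (P x) (parityCell (parity y)) + flipCount r (P x) (parity y)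
  S2-cellOf-lift P x y =
    trans (cong (λ b → S2 r (if b then c₀ else c₁) c₀) (lift-++ P x y)) (sym (S2-from-S3 (P x) (parity y)))

  lift-equitable : (P : Word (2 * r) → Fin 3) → IsEquitable (2 * r) 3 P (S3 r) →
    IsEquitable (2 * r + r) 2 (cellOf (lift P)) (S2 r)
  lift-equitable P E = equitable₂ (lift P) (S2 r) S2-rows (++-elim (2 * r) _ λ x y →
    trans (countB-lift-neighbours P x y)
      (trans (cong (_+ flipCount r (P x) (parity y)) (E x (parityCell (parity y)))) (sym (S2-cellOf-lift P x y))))

  lift-equitable⇒column : (P : Word (2 * r) → Fin 3) → IsEquitable (2 * r + r) 2 (cellOf (lift P)) (S2 r) →
    ∀ x (y : Word r) → nbrsIn (2 * r) (λ z → ⌊ P z ≟ parityCell (parity y) ⌋) x ≡ S3 r (P x) (parityCell (parity y))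
  lift-equitable⇒column P E x y = +-cancelʳ-≡ (flipCount r (P x) (parity y)) _ _
    (trans (sym (countB-lift-neighbours P x y))
      (trans (equitable₂⇒countB (lift P) (S2 r) E (x ⊕ y)) (S2-cellOf-lift P x y)))

  cell₂-flips : (P : Word (2 * r) → Fin 3) → IsEquitable (2 * r) 3 P (S3 r) →
    ∀ x → All (λ z → ⌊ P z ≟ c₂ ⌋ ≡ not ⌊ P x ≟ c₂ ⌋) (neighbours x)
  cell₂-flips P E x = countB⇒All _ (not ⌊ P x ≟ c₂ ⌋) (neighbours x) (begin
    countB (λ z → ⌊ P z ≟ c₂ ⌋) (neighbours x) ≡⟨ nbrsIn≡countB-neighbours (2 * r) _ x ⟨
    nbrsIn (2 * r) (λ z → ⌊ P z ≟ c₂ ⌋) x     ≡⟨ E x c₂ ⟩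
    S3 r (P x) c₂                              ≡⟨ S3-column₂ (P x) ⟩
    (if not ⌊ P x ≟ c₂ ⌋ then 2 * r else 0)    ≡⟨ cong (λ n → if not ⌊ P x ≟ c₂ ⌋ then n else 0) (length-neighbours x) ⟨
    (if not ⌊ P x ≟ c₂ ⌋ then length (neighbours x) else 0) ∎)

  lift-dual : (P : Word (2 * r) → Fin 3) → IsEquitable (2 * r) 3 P (S3 r) → InDual (lift P) (vWord (2 * r + r) r)
  lift-dual P E = inner-constant⇒InDual inC₂⁰ (++-elim (2 * r) _ λ x y x⊕y∈C → begin
    inner (x ⊕ y) (vWord (2 * r + r) r) ≡⟨ inner-prefix x y ⟩
    parity x                             ≡⟨ xor≡false⇒≡ (parity x) inC₂⁰ (begin
      parity x xor inC₂⁰                   ≡⟨ xor-comm (parity x) inC₂⁰ ⟩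
      inC₂⁰ xor parity x                   ≡⟨ flips⇒≡xor-parity (λ z → ⌊ P z ≟ c₂ ⌋) (cell₂-flips P E) x ⟨
      ⌊ P x ≟ c₂ ⌋                         ≡⟨ fibre⇒≢c₂ (P x) (parity y) (trans (sym (lift-++ P x y)) x⊕y∈C) ⟩
      false                                ∎) ⟩
    inC₂⁰                                ∎)
    where
    inC₂⁰ : Bool
    inC₂⁰ = ⌊ P (replicate (2 * r) false) ≟ c₂ ⌋

wordOfParity : (r′ : ℕ) (b : Bool) → Σ (Word (suc r′)) λ y → parity y ≡ b
wordOfParity r′ b = b ∷ replicate r′ false , trans (cong (b xor_) (parity-replicate-false r′)) (xor-identityʳ b)

module _ {r′ : ℕ} where

  lift-injective : (P Q : Word (2 * suc r′) → Fin 3) → lift {k = suc r′} P ≐ lift Q → P ≐ Q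
  lift-injective P Q lift≐ x = fibre-injective (P x) (Q x) λ b →
    let y , parity-y = wordOfParity r′ b in begin
      fibre (P x) b          ≡⟨ cong (fibre (P x)) parity-y ⟨
      fibre (P x) (parity y) ≡⟨ trans (sym (lift-++ P x y)) (trans (lift≐ (x ⊕ y)) (lift-++ Q x y)) ⟩
      fibre (Q x) (parity y) ≡⟨ cong (fibre (Q x)) parity-y ⟩
      fibre (Q x) b          ∎

  lift-equitable⁻¹ : (P : Word (2 * suc r′) → Fin 3) →
    IsEquitable (2 * suc r′ + suc r′) 2 (cellOf (lift P)) (S2 (suc r′)) → IsEquitable (2 * suc r′) 3 P (S3 (suc r′))
  lift-equitable⁻¹ P E = equitable₃ P (S3 (suc r′)) S3-rows (column false) (column true)
    where
    column : ∀ b x → nbrsIn (2 * suc r′) (λ z → ⌊ P z ≟ parityCell b ⌋) x ≡ S3 (suc r′) (P x) (parityCell b)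
    column b x = let y , parity-y = wordOfParity r′ b in
      subst (λ b → nbrsIn (2 * suc r′) (λ z → ⌊ P z ≟ parityCell b ⌋) x ≡ S3 (suc r′) (P x) (parityCell b))
        parity-y (lift-equitable⇒column P E x y)

module Reconstruction {r : ℕ} (C : Word (2 * r + r) → Bool)
  (E : IsEquitable (2 * r + r) 2 (cellOf C) (S2 r)) (C-dual : InDual C (vWord (2 * r + r) r)) where

  p : Bool
  p = proj₁ (InDual⇒inner-constant C-dual)

  C⇒parity≡p : ∀ (x : Word (2 * r)) (y : Word r) → C (x ⊕ y) ≡ true → parity x ≡ p
  C⇒parity≡p x y x⊕y∈C = trans (sym (inner-prefix x y)) (proj₂ (InDual⇒inner-constant C-dual) (x ⊕ y) x⊕y∈C)

  C-off-layer : ∀ (x : Word (2 * r)) (y : Word r) → parity x xor p ≡ true → C (x ⊕ y) ≡ false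
  C-off-layer x y off with C (x ⊕ y) in x⊕y∈C
  ... | false = refl
  ... | true  = contradiction (trans (sym off) (trans (cong (_xor p) (C⇒parity≡p x y x⊕y∈C)) (xor-same p))) λ ()

  countB-C : ∀ w → countB C (neighbours w) ≡ (if C w then 0 else r)
  countB-C w with C w in w∈C
  ... | true  = trans (equitable₂⇒countB C (S2 r) E w) (cong (λ b → S2 r (if b then c₀ else c₁) c₀) w∈C)
  ... | false = trans (equitable₂⇒countB C (S2 r) E w) (cong (λ b → S2 r (if b then c₀ else c₁) c₀) w∈C)

  C-flips-on-layer : ∀ (x : Word (2 * r)) → parity x ≡ p → ∀ (y : Word r) → All (λ y′ → C (x ⊕ y′) ≡ not (C (x ⊕ y))) (neighbours y)
  C-flips-on-layer x on y = countB⇒All _ (not (C (x ⊕ y))) (neighbours y) (begin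
    countB (λ y′ → C (x ⊕ y′)) (neighbours y)
      ≡⟨ cong (_+ countB (λ y′ → C (x ⊕ y′)) (neighbours y)) changing-x ⟨
    countB (λ x′ → C (x′ ⊕ y)) (neighbours x) + countB (λ y′ → C (x ⊕ y′)) (neighbours y)
      ≡⟨ countB-neighbours-++ C x y ⟨
    countB C (neighbours (x ⊕ y))
      ≡⟨ countB-C (x ⊕ y) ⟩
    (if C (x ⊕ y) then 0 else r)
      ≡⟨ if-not (C (x ⊕ y)) ⟩
    (if not (C (x ⊕ y)) then length (neighbours y) else 0) ∎)
    where
    changing-x : countB (λ x′ → C (x′ ⊕ y)) (neighbours x) ≡ 0
    changing-x = countB-All (All.map (λ {x′} e → C-off-layer x′ y
      (trans (cong (_xor p) (trans e (cong not on))) (xor-inverseˡ p))) (parity-neighbours x))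
    if-not : ∀ c → (if c then 0 else r) ≡ (if not c then length (neighbours y) else 0)
    if-not true  = refl
    if-not false = sym (length-neighbours y)

  C-on-layer : ∀ (x : Word (2 * r)) → parity x ≡ p → ∀ (y : Word r) → C (x ⊕ y) ≡ C (x ⊕ replicate r false) xor parity y
  C-on-layer x on = flips⇒≡xor-parity (λ y → C (x ⊕ y)) (C-flips-on-layer x on)

  cell : Word (2 * r) → Fin 3
  cell x = if parity x xor p then c₂ else (if C (x ⊕ replicate r false) then c₀ else c₁)

  C≐lift-cell : C ≐ lift cell
  C≐lift-cell = ++-elim (2 * r) _ λ x y → trans (C-fibre x y) (sym (lift-++ cell x y))
    where
    C-fibre : ∀ (x : Word (2 * r)) (y : Word r) → C (x ⊕ y) ≡ fibre (if parity x xor p then c₂ else (if C (x ⊕ replicate r false) then c₀ else c₁)) (parity y)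
    C-fibre x y with parity x xor p in layer
    ... | true  = C-off-layer x y layer
    ... | false = trans (C-on-layer x (xor≡false⇒≡ (parity x) p layer) y) (sym (fibre-of-bit (C (x ⊕ replicate r false)) (parity y)))

Correspondence : ℕ → ℕ → Set
Correspondence n r =
  Σ ((Word (2 * r) → Fin 3) → (Word n → Bool)) λ F →
    ((P Q : Word (2 * r) → Fin 3) → P ≐ Q → F P ≐ F Q)
    × ((P : Word (2 * r) → Fin 3) → IsEquitable (2 * r) 3 P (S3 r) →
         IsEquitable n 2 (cellOf (F P)) (S2 r) × InDual (F P) (vWord n r))
    × ((P Q : Word (2 * r) → Fin 3) → IsEquitable (2 * r) 3 P (S3 r) →
         IsEquitable (2 * r) 3 Q (S3 r) → F P ≐ F Q → P ≐ Q)
    × ((C : Word n → Bool) → IsEquitable n 2 (cellOf C) (S2 r) → InDual C (vWord n r) →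
         Σ (Word (2 * r) → Fin 3) λ P → IsEquitable (2 * r) 3 P (S3 r) × F P ≐ C)

lift-correspondence : (r′ : ℕ) → Correspondence (2 * suc r′ + suc r′) (suc r′)
lift-correspondence r′ =
  lift , lift-cong , (λ P E → lift-equitable {suc r′} P E , lift-dual {suc r′} P E) , (λ P Q _ _ → lift-injective P Q) , reconstruct
  where
  reconstruct : (C : Word (2 * suc r′ + suc r′) → Bool) → IsEquitable (2 * suc r′ + suc r′) 2 (cellOf C) (S2 (suc r′)) →
    InDual C (vWord (2 * suc r′ + suc r′) (suc r′)) →
    Σ (Word (2 * suc r′) → Fin 3) λ P → IsEquitable (2 * suc r′) 3 P (S3 (suc r′)) × lift P ≐ C
  reconstruct C E C-dual = cell , lift-equitable⁻¹ cell (equitable-resp-≐ {S = S2 (suc r′)} cellOf≐ E) , sym ∘ C≐lift-cell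
    where
    open Reconstruction C E C-dual
    cellOf≐ : cellOf C ≐ cellOf (lift cell)
    cellOf≐ w = cong (λ b → if b then c₀ else c₁) (C≐lift-cell w)

theorem2 : (n r : ℕ) → n ≡ 3 * r → 1 ≤ r →
    Σ ((Word (2 * r) → Fin 3) → (Word n → Bool)) λ F →
      ((P Q : Word (2 * r) → Fin 3) → P ≐ Q → F P ≐ F Q)
      × ((P : Word (2 * r) → Fin 3) → IsEquitable (2 * r) 3 P (S3 r) →
           IsEquitable n 2 (cellOf (F P)) (S2 r) × InDual (F P) (vWord n r))
      × ((P Q : Word (2 * r) → Fin 3) → IsEquitable (2 * r) 3 P (S3 r) →
           IsEquitable (2 * r) 3 Q (S3 r) → F P ≐ F Q → P ≐ Q)
      × ((C : Word n → Bool) → IsEquitable n 2 (cellOf C) (S2 r) → InDual C (vWord n r) →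
           Σ (Word (2 * r) → Fin 3) λ P → IsEquitable (2 * r) 3 P (S3 r) × F P ≐ C)
theorem2 n (suc r′) n≡3r _ =
  subst (λ n → Correspondence n (suc r′)) (sym (trans n≡3r (+-comm (suc r′) (2 * suc r′)))) (lift-correspondence r′)
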